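{- Let $m\ge 3$, $X=\mathbb{F}_{2^m}\setminus\{0,1\}$, and let $W_k$ ($k\ge 2$) be as defined in the context. For each $k\ge 3$, no block of $W_2$ is a subset of any block of $W_k$.
   Context: $\mathbb{F}_{2^m}$ is the finite field with $2^m$ elements, with zero $0$ and unity $1$; all sums are in $\mathbb{F}_{2^m}$. For each integer $k\ge 2$, the collection $W_k$ is defined recursively by $W_k=\{B\subset X : |B|=k,\ \sum_{i\in B} i=1,\ \text{and } \binom{B}{\ell}\cap W_\ell=\emptyset \text{ for all } 2\le \ell\le k-3\}$, where $\binom{B}{\ell}$ denotes the set of $\ell$-element subsets of $B$ (for $k\le 4$ the last condition is vacuous). -}

module Defs where

open import Data.Bool using (Bool; true; false; _xor_)
open import Data.Nat using (ℕ; zero; suc; _≤_; _∸_)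
open import Data.Vec using (Vec; []; _∷_; replicate; zipWith)
open import Data.List using (List; []; _∷_; length; foldr)
open import Data.List.Relation.Unary.All using (All)
open import Data.List.Relation.Unary.Unique.Propositional using (Unique)
open import Data.List.Relation.Binary.Subset.Propositional using (_⊆_)
open import Data.Product using (_×_)
open import Data.Empty using (⊥)
open import Relation.Nullary using (¬_)
open import Relation.Binary.PropositionalEquality using (_≡_)

-- Additive structure of 𝔽_{2^m}: an element is its coordinate vector in the
-- polynomial basis 1, x, …, x^{m-1} of 𝔽₂[x]/(p) (p irreducible of degree m).
-- Addition is coordinatewise XOR; only 0, 1 and + are used by the statement.
F : ℕ → Set
F m = Vec Bool m

_⊕_ : ∀ {m} → F m → F m → F m
_⊕_ = zipWith _xor_

𝟘 : ∀ {m} → F m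
𝟘 = replicate _ false

𝟙 : ∀ {m} → F m
𝟙 {zero}  = []
𝟙 {suc m} = true ∷ replicate m false

Σ⊕ : ∀ {m} → List (F m) → F m
Σ⊕ = foldr _⊕_ 𝟘

InX : ∀ {m} → F m → Set
InX x = ¬ (x ≡ 𝟘) × ¬ (x ≡ 𝟙)

IsBlock : (m k : ℕ) → List (F m) → Set
IsBlock m k B = Unique B × All InX B × length B ≡ k × Σ⊕ B ≡ 𝟙

-- Fuel-indexed version of the recursive definition of W_k.
-- Wf f k B : the inner recursion calls only W_ℓ with ℓ ≤ k ∸ 3 < k,
-- so fuel k is always sufficient (see W below).
Wf : (m : ℕ) → ℕ → ℕ → List (F m) → Set
Wf m zero    k B = ⊥
Wf m (suc f) k B =
  IsBlock m k B ×
  (∀ (C : List (F m)) → Unique C → C ⊆ B →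
     2 ≤ length C → length C ≤ k ∸ 3 → ¬ Wf m f (length C) C)

W : (m k : ℕ) → List (F m) → Set
W m k B = Wf m k k B

module Submission where

-- Let A ∈ W₂ and B ∈ W_k with k ≥ 3, and suppose A = {a, b} ⊆ B.
--
-- • If k ≥ 5, then A is a 2-element subset of B with 2 ≤ k − 3, and A ∈ W₂;
--   this is exactly what the recursive condition defining W_k forbids.
-- • If k ∈ {3, 4}, put R = B ∖ {a, b}.  Since a + b = 1 = Σ B, the set R sums
--   to 0, consists of nonzero elements and has 1 or 2 elements.  One nonzero
--   element cannot sum to 0, and in characteristic 2 two elements summing to 0
--   are equal, contradicting that R is a set.

open import Defs
open import Data.Bool.Properties using (xor-comm; xor-assoc; xor-identityʳ; xor-same)
open import Data.Nat using (ℕ; zero; suc; _≤_; _≤?_; z≤n; s≤s)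
open import Data.Nat.Properties using (≰⇒>; ≤⇒≯; ≤-trans; ≤-reflexive)
open import Data.List using (List; []; _∷_; length)
open import Data.List.Properties using (length-removeAt′)
open import Data.List.Relation.Unary.All as All using (All; []; _∷_)
import Data.List.Relation.Unary.All.Properties as All
open import Data.List.Relation.Unary.Any using (here; there; index)
open import Data.List.Relation.Unary.AllPairs using ([]; _∷_)
open import Data.List.Relation.Unary.Unique.Propositional using (Unique)
open import Data.List.Membership.Propositional using (_∈_; _─_)
open import Data.List.Relation.Binary.Subset.Propositional using (_⊆_)
open import Data.Vec using ([]; _∷_)
open import Data.Vec.Relation.Binary.Pointwise.Inductive
  using (Pointwise-≡⇒≡; zipWith-comm; zipWith-assoc; zipWith-identityʳ)
open import Data.Product using (_,_; proj₁)
open import Data.Empty using (⊥; ⊥-elim)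
open import Relation.Nullary using (¬_; yes; no)
open import Relation.Binary.PropositionalEquality

⊕-comm : ∀ {m} (x y : F m) → x ⊕ y ≡ y ⊕ x
⊕-comm x y = Pointwise-≡⇒≡ (zipWith-comm xor-comm x y)

⊕-assoc : ∀ {m} (x y z : F m) → (x ⊕ y) ⊕ z ≡ x ⊕ (y ⊕ z)
⊕-assoc x y z = Pointwise-≡⇒≡ (zipWith-assoc xor-assoc x y z)

⊕-identityʳ : ∀ {m} (x : F m) → x ⊕ 𝟘 ≡ x
⊕-identityʳ x = Pointwise-≡⇒≡ (zipWith-identityʳ xor-identityʳ x)

⊕-identityˡ : ∀ {m} (x : F m) → 𝟘 ⊕ x ≡ x
⊕-identityˡ x = trans (⊕-comm 𝟘 x) (⊕-identityʳ x)

⊕-self : ∀ {m} (x : F m) → x ⊕ x ≡ 𝟘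
⊕-self []      = refl
⊕-self (b ∷ x) = cong₂ _∷_ (xor-same b) (⊕-self x)

⊕-cancelˡ : ∀ {m} (x : F m) {y z : F m} → x ⊕ y ≡ x ⊕ z → y ≡ z
⊕-cancelˡ x {y} {z} x⊕y≡x⊕z = begin
  y             ≡⟨ sym (⊕-identityˡ y) ⟩
  𝟘 ⊕ y         ≡⟨ cong (_⊕ y) (sym (⊕-self x)) ⟩
  (x ⊕ x) ⊕ y   ≡⟨ ⊕-assoc x x y ⟩
  x ⊕ (x ⊕ y)   ≡⟨ cong (x ⊕_) x⊕y≡x⊕z ⟩
  x ⊕ (x ⊕ z)   ≡⟨ sym (⊕-assoc x x z) ⟩
  (x ⊕ x) ⊕ z   ≡⟨ cong (_⊕ z) (⊕-self x) ⟩
  𝟘 ⊕ z         ≡⟨ ⊕-identityˡ z ⟩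
  z             ∎
  where open ≡-Reasoning

⊕≡𝟘⇒≡ : ∀ {m} (x y : F m) → x ⊕ y ≡ 𝟘 → x ≡ y
⊕≡𝟘⇒≡ x y x⊕y≡𝟘 = sym (⊕-cancelˡ x (trans x⊕y≡𝟘 (sym (⊕-self x))))

∈-─ : ∀ {A : Set} {a b : A} {xs : List A} (p : a ∈ xs) → b ∈ xs → b ≢ a → b ∈ xs ─ p
∈-─ (here refl) (here refl) b≢a = ⊥-elim (b≢a refl)
∈-─ (here _)    (there q)   _   = q
∈-─ (there _)   (here b≡x)  _   = here b≡x
∈-─ (there p)   (there q)   b≢a = there (∈-─ p q b≢a)

Unique-─ : ∀ {A : Set} {a : A} {xs : List A} (p : a ∈ xs) → Unique xs → Unique (xs ─ p)
Unique-─ (here _)  (_ ∷ u)      = u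
Unique-─ (there p) (x∉xs ∷ u)   = All.─⁺ p x∉xs ∷ Unique-─ p u

Σ⊕-─ : ∀ {m} {a : F m} {xs : List (F m)} (p : a ∈ xs) → Σ⊕ xs ≡ a ⊕ Σ⊕ (xs ─ p)
Σ⊕-─ (here refl) = refl
Σ⊕-─ {a = a} {x ∷ xs} (there p) = begin
  x ⊕ Σ⊕ xs     ≡⟨ cong (x ⊕_) (Σ⊕-─ p) ⟩
  x ⊕ (a ⊕ R)   ≡⟨ sym (⊕-assoc x a R) ⟩
  (x ⊕ a) ⊕ R   ≡⟨ cong (_⊕ R) (⊕-comm x a) ⟩
  (a ⊕ x) ⊕ R   ≡⟨ ⊕-assoc a x R ⟩
  a ⊕ (x ⊕ R)   ∎
  where open ≡-Reasoning
        R = Σ⊕ (xs ─ p)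

short-nonzero-sum : ∀ {m} (R : List (F m)) → Unique R → All (λ x → x ≢ 𝟘) R →
  1 ≤ length R → length R ≤ 2 → Σ⊕ R ≢ 𝟘
short-nonzero-sum (c ∷ []) _ (c≢𝟘 ∷ []) _ _ c+𝟘≡𝟘 =
  c≢𝟘 (trans (sym (⊕-identityʳ c)) c+𝟘≡𝟘)
short-nonzero-sum (c ∷ d ∷ []) ((c≢d ∷ []) ∷ _) _ _ _ c+d+𝟘≡𝟘 =
  c≢d (⊕≡𝟘⇒≡ c d (trans (cong (c ⊕_) (sym (⊕-identityʳ d))) c+d+𝟘≡𝟘))
short-nonzero-sum (_ ∷ _ ∷ _ ∷ _) _ _ _ (s≤s (s≤s ()))

-- If a block of size k contains a block {a, b} of size 2, then k ∉ {3, 4}: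
-- the rest of the block is a set of k − 2 nonzero elements summing to 0.
pair-block-not-in-small-block : ∀ {m k} {A B : List (F m)} →
  IsBlock m 2 A → IsBlock m k B → A ⊆ B → 3 ≤ k → k ≤ 4 → ⊥
pair-block-not-in-small-block {m} {A = a ∷ b ∷ []} {B}
  (((a≢b ∷ []) ∷ _) , _ , _ , a+b≡𝟙) (uB , inXB , refl , ΣB≡𝟙) A⊆B 3≤k k≤4 =
  short-nonzero-sum R uR nonzeroR 1≤|R| |R|≤2 ΣR≡𝟘
  where
  a∈B : a ∈ B
  a∈B = A⊆B (here refl)
  b∈B─a : b ∈ B ─ a∈B
  b∈B─a = ∈-─ a∈B (A⊆B (there (here refl))) (λ b≡a → a≢b (sym b≡a))
  R : List (F m)
  R = (B ─ a∈B) ─ b∈B─a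
  uR : Unique R
  uR = Unique-─ b∈B─a (Unique-─ a∈B uB)
  nonzeroR : All (λ x → x ≢ 𝟘) R
  nonzeroR = All.map proj₁ (All.─⁺ b∈B─a (All.─⁺ a∈B inXB))
  |B|≡2+|R| : length B ≡ suc (suc (length R))
  |B|≡2+|R| = trans (length-removeAt′ B (index a∈B))
                    (cong suc (length-removeAt′ (B ─ a∈B) (index b∈B─a)))
  1≤|R| : 1 ≤ length R
  1≤|R| with s≤s (s≤s 1≤|R|′) ← subst (3 ≤_) |B|≡2+|R| 3≤k = 1≤|R|′
  |R|≤2 : length R ≤ 2
  |R|≤2 with s≤s (s≤s |R|≤2′) ← subst (_≤ 4) |B|≡2+|R| k≤4 = |R|≤2′
  -- a + (b + Σ R) = Σ B = 1 = a + (b + 0); cancel a, then b.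
  ΣR≡𝟘 : Σ⊕ R ≡ 𝟘
  ΣR≡𝟘 = ⊕-cancelˡ b (⊕-cancelˡ a (begin
    a ⊕ (b ⊕ Σ⊕ R)   ≡⟨ cong (a ⊕_) (sym (Σ⊕-─ b∈B─a)) ⟩
    a ⊕ Σ⊕ (B ─ a∈B) ≡⟨ sym (Σ⊕-─ a∈B) ⟩
    Σ⊕ B             ≡⟨ trans ΣB≡𝟙 (sym a+b≡𝟙) ⟩
    a ⊕ (b ⊕ 𝟘)      ∎))
    where open ≡-Reasoning

-- Every block of size 2 lies in W₂, at any amount of fuel: the minimality
-- condition ranges over sizes ℓ with 2 ≤ ℓ ≤ 2 − 3 = 0, of which there are none.
pair-block∈Wf : ∀ {m f} {A : List (F m)} → IsBlock m 2 A → Wf m (suc f) 2 A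
pair-block∈Wf blockA = blockA , λ _ _ _ 2≤ℓ ℓ≤0 → ⊥-elim (≤⇒≯ ℓ≤0 (≤-trans (s≤s z≤n) 2≤ℓ))

pair-block-not-in-large-W : ∀ {m k} {A B : List (F m)} →
  IsBlock m 2 A → W m k B → A ⊆ B → 5 ≤ k → ⊥
pair-block-not-in-large-W {m} {A = A} blockA@(uA , _ , |A|≡2 , _) (_ , noSubblock) A⊆B
  (s≤s {n = k′} (s≤s (s≤s (s≤s (s≤s _))))) =
  noSubblock A uA A⊆B (≤-reflexive (sym |A|≡2)) (subst (_≤ _) (sym |A|≡2) (s≤s (s≤s z≤n)))
    (subst (λ ℓ → Wf m k′ ℓ A) (sym |A|≡2) (pair-block∈Wf blockA))

W⇒IsBlock : ∀ {m k} {B : List (F m)} → W m k B → IsBlock m k B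
W⇒IsBlock {k = zero}  ()
W⇒IsBlock {k = suc _} = proj₁

lemma3p5 : (m : ℕ) → 3 ≤ m → (k : ℕ) → 3 ≤ k →
    (A B : List (F m)) → W m 2 A → W m k B → ¬ (A ⊆ B)
lemma3p5 m _ k 3≤k A B A∈W₂ B∈Wk A⊆B with k ≤? 4
... | yes k≤4 = pair-block-not-in-small-block (proj₁ A∈W₂)
                  (W⇒IsBlock B∈Wk) A⊆B 3≤k k≤4
... | no  k≰4 = pair-block-not-in-large-W (proj₁ A∈W₂) B∈Wk A⊆B (≰⇒> k≰4)
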